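{- Let $n = 2p^k$, where $p$ is an odd prime and $k$ is a positive integer. Then $$I_r(\mathbb{Z}/n\mathbb{Z}) = \mathsf{D}((\mathbb{Z}/n\mathbb{Z})^\times) + (k - 1).$$
   Context: For a finite commutative ring $R$, $I_r(R)$ is the smallest positive integer $t$ such that every sequence of $t$ (not necessarily distinct) elements of $R$ contains a nonempty subsequence whose elements multiply to an idempotent element of $R$ (an element $x$ with $x^2=x$). For a finite abelian group $G$, $\mathsf{D}(G)$ (Davenport constant) is the smallest positive integer $t$ such that every sequence of $t$ elements of $G$ contains a nonempty subsequence whose elements multiply to the identity. $(\mathbb{Z}/n\mathbb{Z})^\times$ is the unit group of $\mathbb{Z}/n\mathbb{Z}$. -}

module Defs where

open import Data.Nat using (ℕ; zero; suc; _*_; _≤_)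
open import Data.Integer as ℤ using (ℤ; +_)
open import Data.Integer.Divisibility using () renaming (_∣_ to _∣ℤ_)
open import Data.Nat.Coprimality using (Coprime)
open import Data.Fin using (Fin; toℕ)
open import Data.Fin.Subset using (Subset; Nonempty)
open import Data.Vec using (Vec; []; _∷_)
open import Data.Vec.Relation.Unary.All using (All)
open import Data.Bool using (true; false)
open import Data.Product using (∃; _×_)

_≡_[mod_] : ℕ → ℕ → ℕ → Set
a ≡ b [mod n ] = (+ n) ∣ℤ ((+ a) ℤ.- (+ b))

selProd : ∀ {n t} → Vec (Fin n) t → Subset t → ℕ
selProd [] [] = 1
selProd (a ∷ s) (true ∷ S) = toℕ a * selProd s S
selProd (a ∷ s) (false ∷ S) = selProd s S

IsIdempotentMod : ℕ → ℕ → Set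
IsIdempotentMod n x = (x * x) ≡ x [mod n ]

IrProp : ℕ → ℕ → Set
IrProp n t = (s : Vec (Fin n) t) →
  ∃ λ (S : Subset t) → Nonempty S × IsIdempotentMod n (selProd s S)

IsUnit : (n : ℕ) → Fin n → Set
IsUnit n a = Coprime (toℕ a) n

DProp : ℕ → ℕ → Set
DProp n t = (s : Vec (Fin n) t) → All (IsUnit n) s →
  ∃ λ (S : Subset t) → Nonempty S × (selProd s S ≡ 1 [mod n ])

IsSmallestPos : (ℕ → Set) → ℕ → Set
IsSmallestPos P t = 1 ≤ t × P t × (∀ u → 1 ≤ u → P u → t ≤ u)

Ir≡ : ℕ → ℕ → Set
Ir≡ n t = IsSmallestPos (IrProp n) t

DUnits≡ : ℕ → ℕ → Set
DUnits≡ n t = IsSmallestPos (DProp n) t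

-- Write N = 2q with q = p^k. As x(x − 1) is always even and q is odd, x is idempotent
-- modulo N exactly when q ∣ x(x − 1).
--
-- Among d + k − 1 residues (d = D((ℤ/N)^×)) there are either k multiples
-- of p, whose product is divisible by q, or d residues prime to p. Moving each of the
-- latter by q if necessary makes it odd, hence a unit mod N with the same residue mod q;
-- a subsequence of these units with product 1 mod N then gives a subproduct of the
-- original residues that is 1 mod q.
--
-- For 1 ≤ i < k and p ∤ y, p^i y is never idempotent: p^i divides it while
-- p ∤ p^i y − 1, so p^k ∤ p^i y (p^i y − 1). Hence k − 1 copies of p have no idempotent
-- subproduct, and neither does a sequence of units without a product-one subsequence
-- extended by k − 1 copies of p.
--
-- D exists since prefix products of N units collide modulo N (pigeonhole), and the
-- least admissible length is found by a decidable search.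

module Submission where

open import Defs
open import Data.Nat using (ℕ; _*_; _^_; _+_; _∸_; _≤_)
open import Data.Nat.Primality using (Prime)
open import Data.Nat.Divisibility using (_∣_)
open import Data.Product using (∃; _×_)
open import Relation.Nullary using (¬_)

open import Data.Fin as Fin using (Fin; toℕ)
open import Data.Fin.Properties using (pigeonhole; toℕ-fromℕ<; toℕ<n; fromℕ<-injective)
open import Data.Fin.Subset using (Subset; Nonempty; ⊥; ⊤; ∣_∣; inside; outside)
open import Data.Fin.Subset.Properties using (anySubset?; nonempty?; ∣p∣≤n; ∣⊤∣≡n)
open import Data.Integer as ℤ using (+_)
open import Data.Integer.Properties using (m-n≡m⊖n; ⊖-≥; ∣i-j∣≡∣j-i∣; pos-*)
import Data.Integer.Divisibility.Signed as ℤ∣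
open import Data.Integer.Tactic.RingSolver using (solve-∀)
open import Data.Nat.Base using (zero; suc; _<_; NonZero; z≤n; s≤s; nonTrivial⇒≢1; >-nonZero⁻¹)
open import Data.Nat.Coprimality as Coprime
  using (Coprime; coprime?; coprime-divisor; 1-coprimeTo; 0-coprimeTo-m⇒m≡1)
open import Data.Nat.Divisibility
  using ( divides; _∣?_; _∣0; ∣-refl; ∣-trans; ∣m∣n⇒∣m+n; ∣m+n∣m⇒∣n; n∣m*n; m∣m*n
        ; ∣m⇒∣m*n; ∣n⇒∣m*n; *-pres-∣; *-monoˡ-∣; *-cancelˡ-∣; ∣1⇒≡1; 1∣_)
open import Data.Nat.DivMod using (_%_; _/_; m%n<n; m≡m%n+[m/n]*n)
open import Data.Nat.Primality
  using (prime[2]; prime⇒irreducible; prime⇒nonZero; prime⇒nonTrivial; euclidsLemma)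
open import Data.Nat.Properties
open import Data.Product using (_,_)
open import Data.Sum as Sum using (_⊎_; inj₁; inj₂; [_,_]′)
open import Data.Vec using (Vec; []; _∷_; replicate; _++_; splitAt; here; there)
open import Data.Vec.Relation.Binary.Pointwise.Inductive using (Pointwise; []; _∷_)
open import Data.Vec.Relation.Unary.All as All using (All; []; _∷_)
open import Function using (id; _∘_)
open import Relation.Binary.PropositionalEquality
open import Relation.Nullary using (Dec; yes; no; contradiction)
open import Relation.Nullary.Decidable using (map′; _×-dec_; _→-dec_)
open import Relation.Unary using (Decidable; ∁)
import Data.Fin.Properties as Fin

private variable
  a b c d i j m n s t x : ℕ
  A : Set

≡-mod⇒∣∸ : b ≤ a → a ≡ b [mod n ] → n ∣ a ∸ b
≡-mod⇒∣∸ {b} {a} {n} b≤a = subst (n ∣_) (cong ℤ.∣_∣ (trans (m-n≡m⊖n a b) (⊖-≥ b≤a)))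

∣∸⇒≡-mod : b ≤ a → n ∣ a ∸ b → a ≡ b [mod n ]
∣∸⇒≡-mod {b} {a} {n} b≤a = subst (n ∣_) (sym (cong ℤ.∣_∣ (trans (m-n≡m⊖n a b) (⊖-≥ b≤a))))

≡-mod-refl : a ≡ a [mod n ]
≡-mod-refl {a} {n} = ∣∸⇒≡-mod {a} {a} ≤-refl (subst (n ∣_) (sym (n∸n≡0 a)) (n ∣0))

≡-mod-sym : a ≡ b [mod n ] → b ≡ a [mod n ]
≡-mod-sym {a} {b} {n} = subst (n ∣_) (∣i-j∣≡∣j-i∣ (+ a) (+ b))

private
  toSigned : a ≡ b [mod n ] → + n ℤ∣.∣ (+ a ℤ.- + b)
  toSigned {a} {b} {n} = ℤ∣.∣ᵤ⇒∣ {+ n} {+ a ℤ.- + b}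

  fromSigned : + n ℤ∣.∣ (+ a ℤ.- + b) → a ≡ b [mod n ]
  fromSigned {n} {a} {b} = ℤ∣.∣⇒∣ᵤ {+ n} {+ a ℤ.- + b}

≡-mod-trans : a ≡ b [mod n ] → b ≡ c [mod n ] → a ≡ c [mod n ]
≡-mod-trans {a} {b} {n} {c} a≡b b≡c = fromSigned {n} {a} {c}
  (subst (+ n ℤ∣.∣_) (telescope (+ a) (+ b) (+ c))
    (ℤ∣.∣m∣n⇒∣m+n (toSigned {a} {b} a≡b) (toSigned {b} {c} b≡c)))
  where
  telescope : ∀ i j k → (i ℤ.- j) ℤ.+ (j ℤ.- k) ≡ i ℤ.- k
  telescope = solve-∀

≡-mod-* : a ≡ b [mod n ] → c ≡ d [mod n ] → (a * c) ≡ (b * d) [mod n ]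
≡-mod-* {a} {b} {n} {c} {d} a≡b c≡d = fromSigned {n} {a * c} {b * d}
  (subst (+ n ℤ∣.∣_) (sym expand)
    (ℤ∣.∣m∣n⇒∣m+n (ℤ∣.∣m⇒∣m*n (+ c) (toSigned {a} {b} a≡b))
                  (ℤ∣.∣n⇒∣m*n (+ b) (toSigned {c} {d} c≡d))))
  where
  distrib : ∀ i j k l → i ℤ.* k ℤ.- j ℤ.* l ≡ (i ℤ.- j) ℤ.* k ℤ.+ j ℤ.* (k ℤ.- l)
  distrib = solve-∀
  expand : + (a * c) ℤ.- + (b * d) ≡ (+ a ℤ.- + b) ℤ.* + c ℤ.+ + b ℤ.* (+ c ℤ.- + d)
  expand = trans (cong₂ ℤ._-_ (pos-* a c) (pos-* b d)) (distrib (+ a) (+ b) (+ c) (+ d))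

≡-mod-weaken : m ∣ n → a ≡ b [mod n ] → a ≡ b [mod m ]
≡-mod-weaken = ∣-trans

m+n≡m-mod-n : (a + n) ≡ a [mod n ]
m+n≡m-mod-n {a} {n} = ∣∸⇒≡-mod (m≤m+n a n) (subst (n ∣_) (sym (m+n∸m≡n a n)) ∣-refl)

∣-resp-≡-mod : d ∣ n → a ≡ b [mod n ] → d ∣ b → d ∣ a
∣-resp-≡-mod {d} {n} {a} {b} d∣n a≡b d∣b = ℤ∣.∣⇒∣ᵤ {+ d} {+ a}
  (subst (+ d ℤ∣.∣_) (cancel (+ a) (+ b))
    (ℤ∣.∣m∣n⇒∣m+n (toSigned {a} {b} (≡-mod-weaken {d} {n} {a} {b} d∣n a≡b))
                  (ℤ∣.∣ᵤ⇒∣ {+ d} {+ b} d∣b)))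
  where
  cancel : ∀ i j → (i ℤ.- j) ℤ.+ j ≡ i
  cancel = solve-∀

%≡%⇒∣∸ : ∀ a b n .{{_ : NonZero n}} → a % n ≡ b % n → n ∣ b ∸ a
%≡%⇒∣∸ a b n a%n≡b%n = divides (b / n ∸ a / n) (begin
  b ∸ a                                     ≡⟨ cong₂ _∸_ (m≡m%n+[m/n]*n b n) (m≡m%n+[m/n]*n a n) ⟩
  (b % n + b / n * n) ∸ (a % n + a / n * n) ≡⟨ cong (λ r → (b % n + b / n * n) ∸ (r + a / n * n)) a%n≡b%n ⟩
  (b % n + b / n * n) ∸ (b % n + a / n * n) ≡⟨ [m+n]∸[m+o]≡n∸o (b % n) _ _ ⟩
  b / n * n ∸ a / n * n                     ≡⟨ *-distribʳ-∸ n (b / n) (a / n) ⟨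
  (b / n ∸ a / n) * n                       ∎)
  where open ≡-Reasoning

n≤n*n : ∀ n → n ≤ n * n
n≤n*n zero      = z≤n
n≤n*n n@(suc _) = m≤m*n n n

m*n∸m≡m*[n∸1] : ∀ m n → m * n ∸ m ≡ m * (n ∸ 1)
m*n∸m≡m*[n∸1] m n = begin
  m * n ∸ m     ≡⟨ cong (m * n ∸_) (*-identityʳ m) ⟨
  m * n ∸ m * 1 ≡⟨ *-distribˡ-∸ m n 1 ⟨
  m * (n ∸ 1)   ∎
  where open ≡-Reasoning

idempotent⇒∣ : ∀ x → IsIdempotentMod n x → n ∣ x * (x ∸ 1)
idempotent⇒∣ {n} x idem = subst (n ∣_) (m*n∸m≡m*[n∸1] x x) (≡-mod⇒∣∸ {x} {x * x} (n≤n*n x) idem)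

∣⇒idempotent : ∀ x → n ∣ x * (x ∸ 1) → IsIdempotentMod n x
∣⇒idempotent {n} x n∣ = ∣∸⇒≡-mod {x} {x * x} (n≤n*n x) (subst (n ∣_) (sym (m*n∸m≡m*[n∸1] x x)) n∣)

2∣n*[1+n] : ∀ n → 2 ∣ n * suc n
2∣n*[1+n] zero    = 2 ∣0
2∣n*[1+n] (suc n) = subst (2 ∣_) (sym (*-distribˡ-+ (suc n) 2 n))
  (∣m∣n⇒∣m+n (n∣m*n (suc n)) (subst (2 ∣_) (*-comm n (suc n)) (2∣n*[1+n] n)))

2∣n*[n∸1] : ∀ n → 2 ∣ n * (n ∸ 1)
2∣n*[n∸1] zero    = 2 ∣0
2∣n*[n∸1] (suc n) = subst (2 ∣_) (*-comm n (suc n)) (2∣n*[1+n] n)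

coprime-∣⇒*∣ : Coprime m n → m ∣ a → n ∣ a → m * n ∣ a
coprime-∣⇒*∣ {m} {n} m⊥n m∣a (divides c refl) =
  *-monoˡ-∣ n (coprime-divisor m⊥n (subst (m ∣_) (*-comm c n) m∣a))

∣⇒idempotent-2* : ∀ x → Coprime 2 m → m ∣ x * (x ∸ 1) → IsIdempotentMod (2 * m) x
∣⇒idempotent-2* x 2⊥m m∣ = ∣⇒idempotent x (coprime-∣⇒*∣ 2⊥m (2∣n*[n∸1] x) m∣)

prime⇒≢1 : ∀ {p} → Prime p → p ≢ 1
prime⇒≢1 p-prime = nonTrivial⇒≢1 {{prime⇒nonTrivial p-prime}}

prime∤⇒coprime : ∀ {p} → Prime p → ¬ p ∣ n → Coprime p n
prime∤⇒coprime p-prime p∤n (d∣p , d∣n) with prime⇒irreducible p-prime d∣p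
... | inj₁ d≡1  = d≡1
... | inj₂ refl = contradiction d∣n p∤n

coprime-*ʳ : Coprime a m → Coprime a n → Coprime a (m * n)
coprime-*ʳ a⊥m a⊥n (d∣a , d∣m*n) =
  a⊥n (d∣a , coprime-divisor (λ (e∣d , e∣m) → a⊥m (∣-trans e∣d d∣a , e∣m)) d∣m*n)

coprime-^ʳ : Coprime a m → ∀ e → Coprime a (m ^ e)
coprime-^ʳ {a} a⊥m zero    = Coprime.sym (1-coprimeTo a)
coprime-^ʳ     a⊥m (suc e) = coprime-*ʳ a⊥m (coprime-^ʳ a⊥m e)

coprime-∣∸1⇒≡1 : Coprime x n → n ∣ x ∸ 1 → x ≡ 1 [mod n ]
coprime-∣∸1⇒≡1 {zero}  x⊥n _  rewrite 0-coprimeTo-m⇒m≡1 x⊥n = 1∣ 1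
coprime-∣∸1⇒≡1 {suc x} x⊥n n∣ = ∣∸⇒≡-mod {1} {suc x} (s≤s z≤n) n∣

unit-idempotent⇒≡1 : Coprime x n → IsIdempotentMod n x → x ≡ 1 [mod n ]
unit-idempotent⇒≡1 {x} x⊥n idem =
  coprime-∣∸1⇒≡1 x⊥n (coprime-divisor (Coprime.sym x⊥n) (idempotent⇒∣ x idem))

≡1⇒∣*∸1 : ∀ x → x ≡ 1 [mod n ] → n ∣ x * (x ∸ 1)
≡1⇒∣*∸1 {n} zero    _   = n ∣0
≡1⇒∣*∸1     (suc x) x≡1 = ∣n⇒∣m*n (suc x) (≡-mod⇒∣∸ {1} {suc x} (s≤s z≤n) x≡1)

p^k∤pⁱy*[pⁱy∸1] : ∀ {p y i k} → Prime p → ¬ p ∣ y → 0 < i → i < k →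
  ¬ p ^ k ∣ (p ^ i * y) * (p ^ i * y ∸ 1)
p^k∤pⁱy*[pⁱy∸1] {p} {y} {i} {k} p-prime p∤y 0<i i<k p^k∣ =
  [ p∤y , p∤pⁱy∸1 ]′ (euclidsLemma y (pⁱy ∸ 1) p-prime p∣y*[pⁱy∸1])
  where
  instance
    p≢0 : NonZero p
    p≢0 = prime⇒nonZero p-prime
    pⁱ≢0 : NonZero (p ^ i)
    pⁱ≢0 = m^n≢0 p i
  pⁱy : ℕ
  pⁱy = p ^ i * y
  p∣p^ : ∀ {e} → 0 < e → p ∣ p ^ e
  p∣p^ {suc e} _ = m∣m*n (p ^ e)
  p^k≡pⁱ*p^[k∸i] : p ^ k ≡ p ^ i * p ^ (k ∸ i)
  p^k≡pⁱ*p^[k∸i] = trans (cong (p ^_) (sym (m+[n∸m]≡n (<⇒≤ i<k)))) (^-distribˡ-+-* p i (k ∸ i))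
  p∣y*[pⁱy∸1] : p ∣ y * (pⁱy ∸ 1)
  p∣y*[pⁱy∸1] = ∣-trans (p∣p^ (m<n⇒0<n∸m i<k))
    (*-cancelˡ-∣ (p ^ i) (subst₂ _∣_ p^k≡pⁱ*p^[k∸i] (*-assoc (p ^ i) y (pⁱy ∸ 1)) p^k∣))
  1≤pⁱy : 1 ≤ pⁱy
  1≤pⁱy = *-mono-≤ (m^n>0 p i) (n≢0⇒n>0 λ { refl → p∤y (p ∣0) })
  p∤pⁱy∸1 : ¬ p ∣ pⁱy ∸ 1
  p∤pⁱy∸1 p∣pⁱy∸1 = prime⇒≢1 p-prime
    (∣1⇒≡1 (∣m+n∣m⇒∣n (subst (p ∣_) (sym (m∸n+n≡m 1≤pⁱy)) (∣m⇒∣m*n y (p∣p^ 0<i))) p∣pⁱy∸1))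

odd-representative : ¬ 2 ∣ n → x < 2 * n → ∃ λ y → y < 2 * n × ¬ 2 ∣ y × x ≡ y [mod n ]
odd-representative {n} {x} 2∤n x<2n with 2 ∣? x | x <? n
... | no 2∤x  | _       = x , x<2n , 2∤x , ≡-mod-refl {x}
... | yes 2∣x | yes x<n = x + n , x+n<2n , 2∤x+n , ≡-mod-sym {x + n} {x} (m+n≡m-mod-n {x} {n})
  where
  x+n<2n : x + n < 2 * n
  x+n<2n = subst (x + n <_) (cong (λ z → n + z) (sym (+-identityʳ n))) (+-monoˡ-< n x<n)
  2∤x+n : ¬ 2 ∣ x + n
  2∤x+n 2∣x+n = 2∤n (∣m+n∣m⇒∣n 2∣x+n 2∣x)
... | yes 2∣x | no x≮n  = x ∸ n , ≤-<-trans (m∸n≤m x n) x<2n , 2∤x∸n ,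
  subst (λ z → z ≡ x ∸ n [mod n ]) x∸n+n≡x (m+n≡m-mod-n {x ∸ n} {n})
  where
  x∸n+n≡x : x ∸ n + n ≡ x
  x∸n+n≡x = m∸n+n≡m (≮⇒≥ x≮n)
  2∤x∸n : ¬ 2 ∣ x ∸ n
  2∤x∸n 2∣x∸n = 2∤n (∣m+n∣m⇒∣n (subst (2 ∣_) (sym x∸n+n≡x) 2∣x) 2∣x∸n)

nonempty-∷ : ∀ {b} {S : Subset t} → Nonempty S → Nonempty (b ∷ S)
nonempty-∷ (i , i∈S) = Fin.suc i , there i∈S

nonempty-drop : {S : Subset t} → Nonempty (outside ∷ S) → Nonempty S
nonempty-drop (Fin.suc i , there i∈S) = i , i∈S

nonempty⇒0<∣S∣ : {S : Subset t} → Nonempty S → 0 < ∣ S ∣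
nonempty⇒0<∣S∣ {S = inside ∷ S}  _  = s≤s z≤n
nonempty⇒0<∣S∣ {S = outside ∷ S} ne = nonempty⇒0<∣S∣ (nonempty-drop ne)

nonempty-++⁻ : {S : Subset s} {T : Subset t} → Nonempty (S ++ T) → Nonempty S ⊎ Nonempty T
nonempty-++⁻ {S = []}          ne = inj₂ ne
nonempty-++⁻ {S = inside ∷ S}  _  = inj₁ (Fin.zero , here)
nonempty-++⁻ {S = outside ∷ S} ne = Sum.map₁ nonempty-∷ (nonempty-++⁻ (nonempty-drop ne))

selProd-⊥ : (w : Vec (Fin n) t) → selProd w ⊥ ≡ 1
selProd-⊥ []      = refl
selProd-⊥ (_ ∷ w) = selProd-⊥ w

selProd-++ : (v : Vec (Fin n) s) (w : Vec (Fin n) t) (S : Subset s) (T : Subset t) →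
  selProd (v ++ w) (S ++ T) ≡ selProd v S * selProd w T
selProd-++ []      w []            T = sym (+-identityʳ (selProd w T))
selProd-++ (x ∷ v) w (inside ∷ S)  T =
  trans (cong (toℕ x *_) (selProd-++ v w S T)) (sym (*-assoc (toℕ x) (selProd v S) (selProd w T)))
selProd-++ (x ∷ v) w (outside ∷ S) T = selProd-++ v w S T

selProd-replicate : (x : Fin n) (S : Subset t) → selProd (replicate t x) S ≡ toℕ x ^ ∣ S ∣
selProd-replicate x []            = refl
selProd-replicate x (inside ∷ S)  = cong (toℕ x *_) (selProd-replicate x S)
selProd-replicate x (outside ∷ S) = selProd-replicate x S

selProd-∣ : {w : Vec (Fin n) t} → All (λ x → d ∣ toℕ x) w → (S : Subset t) → d ^ ∣ S ∣ ∣ selProd w S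
selProd-∣ []          []            = ∣-refl
selProd-∣ (d∣x ∷ d∣w) (inside ∷ S)  = *-pres-∣ d∣x (selProd-∣ d∣w S)
selProd-∣ (_ ∷ d∣w)   (outside ∷ S) = selProd-∣ d∣w S

selProd-coprime : {w : Vec (Fin n) t} → All (IsUnit n) w → (S : Subset t) → Coprime (selProd w S) n
selProd-coprime {n} []          []            = 1-coprimeTo n
selProd-coprime     (x⊥n ∷ w⊥n) (inside ∷ S)  =
  Coprime.sym (coprime-*ʳ (Coprime.sym x⊥n) (Coprime.sym (selProd-coprime w⊥n S)))
selProd-coprime     (_ ∷ w⊥n)   (outside ∷ S) = selProd-coprime w⊥n S

selProd-≡-mod : {v w : Vec (Fin n) t} → Pointwise (λ x y → toℕ x ≡ toℕ y [mod m ]) v w →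
  (S : Subset t) → selProd v S ≡ selProd w S [mod m ]
selProd-≡-mod []                            []            = ≡-mod-refl {1}
selProd-≡-mod {v = x ∷ v} {y ∷ w} (x≡y ∷ v≡w) (inside ∷ S)  =
  ≡-mod-* {toℕ x} {toℕ y} {_} {selProd v S} {selProd w S} x≡y (selProd-≡-mod v≡w S)
selProd-≡-mod                     (_ ∷ v≡w)   (outside ∷ S) = selProd-≡-mod v≡w S

-- Subsequences

infix 4 _⊆_

data _⊆_ {A : Set} : Vec A m → Vec A n → Set where
  []   : [] ⊆ []
  _∷ʳ_ : ∀ y {xs : Vec A m} {ys : Vec A n} → xs ⊆ ys → xs ⊆ y ∷ ys
  _∷_  : ∀ x {xs : Vec A m} {ys : Vec A n} → xs ⊆ ys → x ∷ xs ⊆ x ∷ ys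

[]⊆ : (ys : Vec A n) → [] ⊆ ys
[]⊆ []       = []
[]⊆ (y ∷ ys) = y ∷ʳ []⊆ ys

embed : {xs : Vec A m} {ys : Vec A n} → xs ⊆ ys → Subset m → Subset n
embed []       []      = []
embed (y ∷ʳ σ) S       = outside ∷ embed σ S
embed (x ∷ σ)  (b ∷ S) = b ∷ embed σ S

selProd-embed : {xs : Vec (Fin n) m} {ys : Vec (Fin n) t} (σ : xs ⊆ ys) (S : Subset m) →
  selProd ys (embed σ S) ≡ selProd xs S
selProd-embed []       []            = refl
selProd-embed (y ∷ʳ σ) S             = selProd-embed σ S
selProd-embed (x ∷ σ)  (inside ∷ S)  = cong (toℕ x *_) (selProd-embed σ S)
selProd-embed (x ∷ σ)  (outside ∷ S) = selProd-embed σ S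

embed-nonempty : {xs : Vec A m} {ys : Vec A n} (σ : xs ⊆ ys) {S : Subset m} →
  Nonempty S → Nonempty (embed σ S)
embed-nonempty (y ∷ʳ σ)              ne = nonempty-∷ (embed-nonempty σ ne)
embed-nonempty (x ∷ σ) {inside ∷ S}  _  = Fin.zero , here
embed-nonempty (x ∷ σ) {outside ∷ S} ne = nonempty-∷ (embed-nonempty σ (nonempty-drop ne))

partition : {P : A → Set} → Decidable P → ∀ a b (ys : Vec A t) → a + b ≤ suc t →
  (∃ λ (xs : Vec A a) → xs ⊆ ys × All P xs) ⊎ (∃ λ (xs : Vec A b) → xs ⊆ ys × All (∁ P) xs)
partition P? zero    b       ys _ = inj₁ ([] , []⊆ ys , [])
partition P? (suc a) zero    ys _ = inj₂ ([] , []⊆ ys , [])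
partition P? (suc a) (suc b) [] (s≤s a+1+b≤0) = contradiction (subst (_≤ 0) (+-suc a b) a+1+b≤0) λ ()
partition {t = suc t} P? (suc a) (suc b) (y ∷ ys) a+b≤2+t with P? y
... | yes Py = Sum.map (λ (xs , σ , Pxs) → y ∷ xs , y ∷ σ , Py ∷ Pxs)
                       (λ (xs , σ , ∁Pxs) → xs , y ∷ʳ σ , ∁Pxs)
                       (partition P? a (suc b) ys (≤-pred a+b≤2+t))
... | no ¬Py = Sum.map (λ (xs , σ , Pxs) → xs , y ∷ʳ σ , Pxs)
                       (λ (xs , σ , ∁Pxs) → y ∷ xs , y ∷ σ , ¬Py ∷ ∁Pxs)
                       (partition P? (suc a) b ys (≤-pred (subst (_≤ 2 + t) (+-suc (suc a) b) a+b≤2+t)))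

-- The Davenport constant exists

-- segment i j selects the positions i, …, j − 1.
segment : ℕ → ℕ → Subset t
segment {zero}  _       _       = []
segment {suc t} _       zero    = ⊥
segment {suc t} zero    (suc j) = inside ∷ segment zero j
segment {suc t} (suc i) (suc j) = outside ∷ segment i j

selProd-segment : (w : Vec (Fin n) t) → i ≤ j →
  selProd w (segment 0 j) ≡ selProd w (segment 0 i) * selProd w (segment i j)
selProd-segment []      _ = refl
selProd-segment {i = zero} {zero} (x ∷ w) _ =
  trans (selProd-⊥ w) (cong₂ _*_ (sym (selProd-⊥ w)) (sym (selProd-⊥ w)))
selProd-segment {i = zero} {suc j} (x ∷ w) _ =
  sym (trans (cong (_* (toℕ x * selProd w (segment 0 j))) (selProd-⊥ w)) (*-identityˡ _))
selProd-segment {i = suc i} {suc j} (x ∷ w) (s≤s i≤j) =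
  trans (cong (toℕ x *_) (selProd-segment w i≤j))
        (sym (*-assoc (toℕ x) (selProd w (segment 0 i)) (selProd w (segment i j))))

segment-nonempty : i < j → j ≤ t → Nonempty (segment {t} i j)
segment-nonempty {zero}  {suc j} {suc t} _         _         = Fin.zero , here
segment-nonempty {suc i} {suc j} {suc t} (s≤s i<j) (s≤s j≤t) = nonempty-∷ (segment-nonempty i<j j≤t)

segment-≡1 : .{{_ : NonZero n}} {w : Vec (Fin n) t} → All (IsUnit n) w → i ≤ j →
  selProd w (segment 0 i) % n ≡ selProd w (segment 0 j) % n → selProd w (segment i j) ≡ 1 [mod n ]
segment-≡1 {n} {i = i} {j} {w = w} w⊥n i≤j same =
  coprime-∣∸1⇒≡1 (selProd-coprime w⊥n (segment i j))
    (coprime-divisor (Coprime.sym (selProd-coprime w⊥n (segment 0 i)))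
      (subst (n ∣_) (m*n∸m≡m*[n∸1] pre seg) n∣pre*seg∸pre))
  where
  pre seg : ℕ
  pre = selProd w (segment 0 i)
  seg = selProd w (segment i j)
  n∣pre*seg∸pre : n ∣ pre * seg ∸ pre
  n∣pre*seg∸pre =
    %≡%⇒∣∸ pre (pre * seg) n (subst (λ z → pre % n ≡ z % n) (selProd-segment w i≤j) same)

davenport-bound : ∀ n .{{_ : NonZero n}} → DProp n n
davenport-bound n w w⊥n =
  let i , j , i<j , same = pigeonhole (n<1+n n) residue
  in segment (toℕ i) (toℕ j) , segment-nonempty i<j (≤-pred (toℕ<n j)) ,
     segment-≡1 w⊥n (<⇒≤ i<j) (fromℕ<-injective _ _ (m%n<n _ n) (m%n<n _ n) same)
  where
  residue : Fin (suc n) → Fin n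
  residue i = Fin.fromℕ< (m%n<n (selProd w (segment 0 (toℕ i))) n)

all-vectors? : {P : Vec (Fin n) t → Set} → (∀ v → Dec (P v)) → Dec (∀ v → P v)
all-vectors? {t = zero}  P? = map′ (λ P[] → λ { [] → P[] }) (λ ∀P → ∀P []) (P? [])
all-vectors? {t = suc t} P? = map′ (λ ∀P → λ { (x ∷ v) → ∀P x v }) (λ ∀P x v → ∀P (x ∷ v))
  (Fin.all? λ x → all-vectors? λ v → P? (x ∷ v))

≡-mod? : ∀ a b n → Dec (a ≡ b [mod n ])
≡-mod? a b n = n ∣? ℤ.∣ + a ℤ.- + b ∣

DProp? : ∀ n t → Dec (DProp n t)
DProp? n t = all-vectors? λ w →
  All.all? (λ x → coprime? (toℕ x) n) w →-dec
  anySubset? λ S → nonempty? S ×-dec ≡-mod? (selProd w S) 1 n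

least-or-none : {P : ℕ → Set} → Decidable P → ∀ n →
  (∃ λ m → P m × (∀ {u} → P u → m ≤ u)) ⊎ (∀ {u} → u < n → ¬ P u)
least-or-none P? zero = inj₂ λ ()
least-or-none P? (suc n) with least-or-none P? n
... | inj₁ least = inj₁ least
... | inj₂ none with P? n
...   | yes Pn  = inj₁ (n , Pn , λ Pu → ≮⇒≥ λ u<n → none u<n Pu)
...   | no  ¬Pn = inj₂ λ u<1+n → [ none , (λ { refl → ¬Pn }) ]′ (m<1+n⇒m<n∨m≡n u<1+n)

least-positive : {P : ℕ → Set} → Decidable P → 1 ≤ n → P n → ∃ (IsSmallestPos P)
least-positive {n} P? 1≤n Pn with least-or-none (λ u → 1 ≤? u ×-dec P? u) (suc n)
... | inj₁ (m , (1≤m , Pm) , minimal) = m , 1≤m , Pm , λ u 1≤u Pu → minimal (1≤u , Pu)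
... | inj₂ none                        = contradiction (1≤n , Pn) (none (n<1+n n))

-- The modulus 2p^(j+1)

module TwicePrimePower {p : ℕ} (j : ℕ) (p-prime : Prime p) (p-odd : ¬ 2 ∣ p) where

  q N : ℕ
  q = p ^ suc j
  N = 2 * q

  instance
    p≢0 : NonZero p
    p≢0 = prime⇒nonZero p-prime
    N≢0 : NonZero N
    N≢0 = m*n≢0 2 q {{_}} {{m^n≢0 p (suc j)}}

  p∣q : p ∣ q
  p∣q = m∣m*n (p ^ j)

  q∣N : q ∣ N
  q∣N = n∣m*n 2

  1≤N : 1 ≤ N
  1≤N = >-nonZero⁻¹ N

  p<N : p < N
  p<N = ≤-<-trans (m≤m*n p (p ^ j) {{m^n≢0 p j}})
                  (m<m+n q (subst (0 <_) (sym (+-identityʳ q)) (m^n>0 p (suc j))))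

  2⊥q : Coprime 2 q
  2⊥q = coprime-^ʳ (prime∤⇒coprime prime[2] p-odd) (suc j)

  2∤q : ¬ 2 ∣ q
  2∤q 2∣q = contradiction (2⊥q (∣-refl , 2∣q)) λ ()

  2∤∧p∤⇒unit : ∀ {y} → ¬ 2 ∣ y → ¬ p ∣ y → Coprime y N
  2∤∧p∤⇒unit 2∤y p∤y = coprime-*ʳ (Coprime.sym (prime∤⇒coprime prime[2] 2∤y))
                                  (coprime-^ʳ (Coprime.sym (prime∤⇒coprime p-prime p∤y)) (suc j))

  unit⇒p∤ : ∀ {y} → Coprime y N → ¬ p ∣ y
  unit⇒p∤ y⊥N p∣y = prime⇒≢1 p-prime (y⊥N (p∣y , ∣-trans p∣q q∣N))

  to-unit : (x : Fin N) → ¬ p ∣ toℕ x → ∃ λ (u : Fin N) → IsUnit N u × toℕ x ≡ toℕ u [mod q ]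
  to-unit x p∤x with odd-representative 2∤q (toℕ<n x)
  ... | y , y<N , 2∤y , x≡y = Fin.fromℕ< y<N ,
    subst (λ z → Coprime z N) y≡u (2∤∧p∤⇒unit 2∤y (p∤x ∘ ∣-resp-≡-mod {p} {q} {toℕ x} {y} p∣q x≡y)) ,
    subst (λ z → toℕ x ≡ z [mod q ]) y≡u x≡y
    where
    y≡u : y ≡ toℕ (Fin.fromℕ< y<N)
    y≡u = sym (toℕ-fromℕ< y<N)

  to-units : {xs : Vec (Fin N) a} → All (λ x → ¬ p ∣ toℕ x) xs →
    ∃ λ (us : Vec (Fin N) a) → All (IsUnit N) us × Pointwise (λ x u → toℕ x ≡ toℕ u [mod q ]) xs us
  to-units []                         = [] , [] , []
  to-units {xs = x ∷ xs} (p∤x ∷ p∤xs) =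
    let u , u⊥N , x≡u     = to-unit x p∤x
        us , us⊥N , xs≡us = to-units p∤xs
    in u ∷ us , u⊥N ∷ us⊥N , x≡u ∷ xs≡us

  HasIdempotentSubproduct : Vec (Fin N) t → Set
  HasIdempotentSubproduct {t} s = ∃ λ (S : Subset t) → Nonempty S × IsIdempotentMod N (selProd s S)

  p-multiples⇒idempotent : {xs : Vec (Fin N) (suc j)} {s : Vec (Fin N) t} →
    xs ⊆ s → All (λ x → p ∣ toℕ x) xs → HasIdempotentSubproduct s
  p-multiples⇒idempotent {xs = xs} {s} σ p∣xs = embed σ ⊤ , embed-nonempty σ (Fin.zero , here) ,
    ∣⇒idempotent-2* (selProd s (embed σ ⊤)) 2⊥q (∣m⇒∣m*n _ q∣s)
    where
    q∣s : q ∣ selProd s (embed σ ⊤)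
    q∣s = subst₂ (λ e z → p ^ e ∣ z) (∣⊤∣≡n (suc j)) (sym (selProd-embed σ ⊤)) (selProd-∣ p∣xs ⊤)

  non-multiples⇒idempotent : DProp N d → {xs : Vec (Fin N) d} {s : Vec (Fin N) t} →
    xs ⊆ s → All (λ x → ¬ p ∣ toℕ x) xs → HasIdempotentSubproduct s
  non-multiples⇒idempotent D-d {xs} {s} σ p∤xs with to-units p∤xs
  ... | us , us⊥N , xs≡us with D-d us us⊥N
  ... | S , S≢∅ , us≡1 = embed σ S , embed-nonempty σ S≢∅ ,
    ∣⇒idempotent-2* (selProd s (embed σ S)) 2⊥q (≡1⇒∣*∸1 (selProd s (embed σ S)) s≡1)
    where
    s≡1 : selProd s (embed σ S) ≡ 1 [mod q ]
    s≡1 = subst (λ z → z ≡ 1 [mod q ]) (sym (selProd-embed σ S))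
      (≡-mod-trans {selProd xs S} {selProd us S} {q} {1} (selProd-≡-mod xs≡us S)
        (≡-mod-weaken {q} {N} {selProd us S} {1} q∣N us≡1))

  DProp⇒IrProp : DProp N d → IrProp N (d + j)
  DProp⇒IrProp {d} D-d s =
    [ (λ (_ , σ , p∣xs) → p-multiples⇒idempotent σ p∣xs)
    , (λ (_ , σ , p∤xs) → non-multiples⇒idempotent D-d σ p∤xs)
    ]′ (partition (λ x → p ∣? toℕ x) (suc j) d s (s≤s (≤-reflexive (+-comm j d))))

  pᶠ : Fin N
  pᶠ = Fin.fromℕ< p<N

  selProd-p : (S : Subset t) → selProd (replicate t pᶠ) S ≡ p ^ ∣ S ∣
  selProd-p S = trans (selProd-replicate pᶠ S) (cong (_^ ∣ S ∣) (toℕ-fromℕ< p<N))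

  pⁱy-not-idempotent : ∀ {y i} → ¬ p ∣ y → 0 < i → i ≤ j → ¬ IsIdempotentMod N (p ^ i * y)
  pⁱy-not-idempotent {y} {i} p∤y 0<i i≤j idem =
    p^k∤pⁱy*[pⁱy∸1] p-prime p∤y 0<i (s≤s i≤j) (∣-trans q∣N (idempotent⇒∣ (p ^ i * y) idem))

  IrProp⇒1+j≤ : IrProp N t → suc j ≤ t
  IrProp⇒1+j≤ {t} ir with ir (replicate t pᶠ)
  ... | S , S≢∅ , idem = ≮⇒≥ λ t≤j →
    pⁱy-not-idempotent (prime⇒≢1 p-prime ∘ ∣1⇒≡1) (nonempty⇒0<∣S∣ S≢∅)
      (≤-trans (∣p∣≤n S) (≤-pred t≤j))
      (subst (IsIdempotentMod N) (trans (selProd-p S) (sym (*-identityʳ _))) idem)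

  IrProp⇒DProp : IrProp N (m + j) → DProp N m
  IrProp⇒DProp {m} ir w w⊥N with ir (w ++ replicate j pᶠ)
  ... | S , S≢∅ , idem with splitAt m S
  ... | S₁ , S₂ , refl =
    S₁ , [ id , (λ S₂≢∅ → contradiction (nonempty⇒0<∣S∣ S₂≢∅) S₂-empty) ]′ (nonempty-++⁻ S≢∅) ,
    unit-idempotent⇒≡1 y⊥N (subst (IsIdempotentMod N) y*pᵉ≡y idem)
    where
    y : ℕ
    y = selProd w S₁
    y⊥N : Coprime y N
    y⊥N = selProd-coprime w⊥N S₁
    y*pᵉ : selProd (w ++ replicate j pᶠ) (S₁ ++ S₂) ≡ y * p ^ ∣ S₂ ∣
    y*pᵉ = trans (selProd-++ w (replicate j pᶠ) S₁ S₂) (cong (y *_) (selProd-p S₂))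
    S₂-empty : ¬ 0 < ∣ S₂ ∣
    S₂-empty 0<∣S₂∣ = pⁱy-not-idempotent (unit⇒p∤ y⊥N) 0<∣S₂∣ (∣p∣≤n S₂)
      (subst (IsIdempotentMod N) (trans y*pᵉ (*-comm y _)) idem)
    y*pᵉ≡y : selProd (w ++ replicate j pᶠ) (S₁ ++ S₂) ≡ y
    y*pᵉ≡y = trans y*pᵉ (trans (cong (λ e → y * p ^ e) (n≤0⇒n≡0 (≮⇒≥ S₂-empty))) (*-identityʳ y))

  IrProp⇒d+j≤ : (∀ u → 1 ≤ u → DProp N u → d ≤ u) → ∀ u → 1 ≤ u → IrProp N u → d + j ≤ u
  IrProp⇒d+j≤ {d} d-min u _ ir = subst (d + j ≤_) u∸j+j≡u
    (+-monoˡ-≤ j (d-min (u ∸ j) (m<n⇒0<n∸m j<u) (IrProp⇒DProp (subst (IrProp N) (sym u∸j+j≡u) ir))))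
    where
    j<u : j < u
    j<u = IrProp⇒1+j≤ ir
    u∸j+j≡u : u ∸ j + j ≡ u
    u∸j+j≡u = m∸n+n≡m (<⇒≤ j<u)

corollary3p2 : (p k : ℕ) → Prime p → ¬ (2 ∣ p) → 1 ≤ k →
    ∃ λ d → DUnits≡ (2 * p ^ k) d × Ir≡ (2 * p ^ k) (d + (k ∸ 1))
corollary3p2 p (suc j) p-prime p-odd _ =
  let d , 1≤d , D-d , d-min = least-positive (DProp? N) 1≤N (davenport-bound N)
  in d , (1≤d , D-d , d-min) , (≤-trans 1≤d (m≤m+n d j) , DProp⇒IrProp D-d , IrProp⇒d+j≤ d-min)
  where open TwicePrimePower j p-prime p-odd
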